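{- Let $S$ be a set of cardinality $n$, let $2 \leq r \leq n-1$, and fix $X \in \binom{S}{r}$. For $0 \leq h \leq r$ put $p_h := \binom{n-r}{r-h}$, $q_h := \binom{r}{h}$, $m_h := \max\{p_h, q_h\}$, enumerate the $h$-subsets of $X$ as $A^{(h)}_1, \dots, A^{(h)}_{q_h}$ and the $(r-h)$-subsets of $S \setminus X$ as $Z^{(h)}_1, \dots, Z^{(h)}_{p_h}$. For $1 \leq j \leq m_h$ define $s_h(j) \subseteq \binom{S}{r}$ as follows: if $q_h \leq p_h$, then $s_h(j) := \{A^{(h)}_t \cup Z^{(h)}_{\sigma(t)} : 1 \leq t \leq q_h\}$ where $\sigma(t) \in \{1,\dots,p_h\}$ is the representative of $j+t-1$ modulo $p_h$; if $q_h > p_h$, then $s_h(j) := \{A^{(h)}_{\tau(i)} \cup Z^{(h)}_{i} : 1 \leq i \leq p_h\}$ where $\tau(i) \in \{1,\dots,q_h\}$ is the representative of $j+i-1$ modulo $q_h$. For $j > m_h$ set $s_h(j) := \emptyset$. Let $\alpha := \max_{0 \leq h \leq r,\ h \text{ odd}} m_h$ and $\beta := \max_{0 \leq h \leq r,\ h \text{ even}} m_h$, and define $\mathcal{U}^{(odd)}_j := \bigcup_{0 \leq h \leq r,\ h \text{ odd}} s_h(j)$ for $1 \leq j \leq \alpha$ and $\mathcal{U}^{(even)}_j := \bigcup_{0 \leq h \leq r,\ h \text{ even}} s_h(j)$ for $1 \leq j \leq \beta$. Then each $\mathcal{U}^{(odd)}_j$ and each $\mathcal{U}^{(even)}_j$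 has property $(\ast\ast)$: any two distinct members intersect in at most $r-2$ elements. Moreover, the $\gamma := \alpha + \beta$ sets $\mathcal{U}^{(odd)}_1, \dots, \mathcal{U}^{(odd)}_\alpha, \mathcal{U}^{(even)}_1, \dots, \mathcal{U}^{(even)}_\beta$ are pairwise disjoint and their union is $\binom{S}{r}$.
   Context: $\binom{S}{t}$ denotes the set of $t$-element subsets of $S$. -}

module Defs where

open import Data.Nat using (ℕ; zero; suc; _≤_; _<_; _∸_; _+_; _⊔_; _%_)
open import Data.Nat.Combinatorics using (_C_)
open import Data.Bool using (Bool; true; false; not; if_then_else_)
open import Data.Fin using (Fin; toℕ)
open import Data.Fin.Subset using (Subset; _⊆_; ∁; _∪_; ∣_∣)
open import Data.Product using (Σ; _×_; ∃)
open import Data.Sum using (_⊎_)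
open import Function.Definitions using (Injective)
open import Relation.Binary.PropositionalEquality using (_≡_)

IsEnumeration : {n k : ℕ} → (Subset n → Set) → (Fin k → Subset n) → Set
IsEnumeration {n} {k} P E =
  Injective _≡_ _≡_ E × ((t : Fin k) → P (E t)) × ((B : Subset n) → P B → ∃ λ t → E t ≡ B)

_-SubsetOf_ : {n : ℕ} → ℕ → Subset n → Subset n → Set
(h -SubsetOf Y) B = B ⊆ Y × ∣ B ∣ ≡ h

pp : (n r h : ℕ) → ℕ
pp n r h = (n ∸ r) C (r ∸ h)

qq : (r h : ℕ) → ℕ
qq r h = r C h

mm : (n r h : ℕ) → ℕ
mm n r h = pp n r h ⊔ qq r h

-- remainder; the divisor-zero case is never used meaningfully
-- (it only occurs when Fin 0 is empty)
_%'_ : ℕ → ℕ → ℕ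
a %' zero = a
a %' suc k = a % suc k

isOdd : ℕ → Bool
isOdd zero = false
isOdd (suc k) = not (isOdd k)

maxWhere : (ℕ → Bool) → (ℕ → ℕ) → ℕ → ℕ
maxWhere P f zero = if P zero then f zero else 0
maxWhere P f (suc k) = maxWhere P f k ⊔ (if P (suc k) then f (suc k) else 0)

αβ : (n r : ℕ) → Bool → ℕ
αβ n r true  = maxWhere isOdd (mm n r) r
αβ n r false = maxWhere (λ h → not (isOdd h)) (mm n r) r

-- membership B ∈ s_h(j); index t (resp. i) is 0-based, i.e. t = t₁ - 1,
-- so sigma(t₁) - 1 = (j - 1 + t₁ - 1) mod p
sMem : {n : ℕ} (r : ℕ) →
       (A : (h : ℕ) → Fin (qq r h) → Subset n) →
       (Z : (h : ℕ) → Fin (pp n r h) → Subset n) →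
       (h j : ℕ) → Subset n → Set
sMem {n} r A Z h j B =
  1 ≤ j × j ≤ mm n r h ×
  ( (qq r h ≤ pp n r h ×
      Σ (Fin (qq r h)) λ t → Σ (Fin (pp n r h)) λ u →
        toℕ u ≡ (j ∸ 1 + toℕ t) %' pp n r h × B ≡ A h t ∪ Z h u)
  ⊎ (pp n r h < qq r h ×
      Σ (Fin (pp n r h)) λ i → Σ (Fin (qq r h)) λ u →
        toℕ u ≡ (j ∸ 1 + toℕ i) %' qq r h × B ≡ A h u ∪ Z h i))

UMem : {n : ℕ} (r : ℕ) →
       (A : (h : ℕ) → Fin (qq r h) → Subset n) →
       (Z : (h : ℕ) → Fin (pp n r h) → Subset n) →
       Bool → ℕ → Subset n → Set
UMem r A Z b j B = Σ ℕ λ h → h ≤ r × isOdd h ≡ b × sMem r A Z h j B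

-- Every r-set B splits as (B ∩ X) ∪ (B ∩ ∁X) with level h = |B ∩ X|, so the r-sets of level h
-- form a q_h × p_h grid A_t ∪ Z_u, and s_h(j) is the j-th wrapped diagonal along the longer
-- side. Cyclic shifts are injective modulo the side length, so each diagonal meets every row
-- and column at most once, and the diagonals partition the grid. Two distinct cells on one
-- diagonal differ both in their X-part and in their ∁X-part, so they share at most
-- (h - 1) + (r - h - 1) = r - 2 points; two cells at levels of equal parity differ in level
-- by at least 2, so they share at most h + (r - h') ≤ r - 2 points.
module Submission where

open import Defs
open import Data.Nat using (ℕ; zero; suc; _≤_; _<_; _∸_; _+_; _⊔_; _%_; z≤n; s≤s; NonZero)
open import Data.Nat.Properties
open import Data.Nat.DivMod using (%-distribˡ-+; m%n%n≡m%n; [m+n]%n≡m%n; m<n⇒m%n≡m; m%n≤n; m%n<n)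
open import Data.Bool using (Bool; true; false; not)
open import Data.Bool.Properties using (not-¬)
open import Data.Fin using (Fin; toℕ)
open import Data.Fin.Properties using (toℕ-injective; toℕ<n)
open import Data.Fin.Subset using (Subset; ⊥; ⊤; ∁; _∩_; _∪_; ∣_∣; _⊆_)
open import Data.Fin.Subset.Properties
  using ( drop-∷-⊆; p∩q⊆q; ∣p∩q∣≤∣p∣; ∣p∩q∣≤∣q∣; ∣p∣≤∣p∪q∣
        ; ∩-assoc; ∩-comm; ∩-zeroʳ; ∩-identityʳ; ∩-inverseˡ; ∩-inverseʳ; ∩-distribˡ-∪; ∩-distribʳ-∪
        ; ∪-comm; ∪-identityʳ; ∪-inverseʳ; ∩-idempotentCommutativeMonoid )
import Algebra.Properties.IdempotentCommutativeMonoid as IdempotentCommutativeMonoidProperties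
open import Data.Vec using ([]; _∷_; here)
open import Data.Product using (Σ; ∃; _×_; _,_; proj₁; proj₂)
open import Data.Sum using (_⊎_; inj₁; inj₂)
open import Function using (_∘_)
open import Relation.Binary.Definitions using (tri<; tri≈; tri>)
open import Relation.Binary.PropositionalEquality
open import Relation.Nullary using (¬_; yes; no; contradiction)

p⊆q⇒p∩q≡p : ∀ {n} {p q : Subset n} → p ⊆ q → p ∩ q ≡ p
p⊆q⇒p∩q≡p {p = []}        {[]}        _   = refl
p⊆q⇒p∩q≡p {p = true ∷ p}  {true ∷ q}  p⊆q = cong (true ∷_) (p⊆q⇒p∩q≡p (drop-∷-⊆ p⊆q))
p⊆q⇒p∩q≡p {p = true ∷ p}  {false ∷ q} p⊆q = contradiction (p⊆q here) λ ()
p⊆q⇒p∩q≡p {p = false ∷ p} {_ ∷ q}     p⊆q = cong (false ∷_) (p⊆q⇒p∩q≡p (drop-∷-⊆ p⊆q))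

p⊆q∧q∩r≡⊥⇒p∩r≡⊥ : ∀ {n} {p q r : Subset n} → p ⊆ q → q ∩ r ≡ ⊥ → p ∩ r ≡ ⊥
p⊆q∧q∩r≡⊥⇒p∩r≡⊥ {p = p} {q} {r} p⊆q q∩r≡⊥ = begin
  p ∩ r        ≡⟨ cong (_∩ r) (p⊆q⇒p∩q≡p p⊆q) ⟨
  (p ∩ q) ∩ r  ≡⟨ ∩-assoc p q r ⟩
  p ∩ (q ∩ r)  ≡⟨ cong (p ∩_) q∩r≡⊥ ⟩
  p ∩ ⊥        ≡⟨ ∩-zeroʳ p ⟩
  ⊥            ∎
  where open ≡-Reasoning

[p∪q]∩r≡p : ∀ {n} {p q r : Subset n} → p ∩ r ≡ p → q ∩ r ≡ ⊥ → (p ∪ q) ∩ r ≡ p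
[p∪q]∩r≡p {p = p} {q} {r} p∩r≡p q∩r≡⊥ = begin
  (p ∪ q) ∩ r        ≡⟨ ∩-distribʳ-∪ r p q ⟩
  (p ∩ r) ∪ (q ∩ r)  ≡⟨ cong₂ _∪_ p∩r≡p q∩r≡⊥ ⟩
  p ∪ ⊥              ≡⟨ ∪-identityʳ p ⟩
  p                  ∎
  where open ≡-Reasoning

p≡[p∩q]∪[p∩∁q] : ∀ {n} (p q : Subset n) → p ≡ (p ∩ q) ∪ (p ∩ ∁ q)
p≡[p∩q]∪[p∩∁q] p q = begin
  p                    ≡⟨ ∩-identityʳ p ⟨
  p ∩ ⊤                ≡⟨ cong (p ∩_) (∪-inverseʳ q) ⟨
  p ∩ (q ∪ ∁ q)        ≡⟨ ∩-distribˡ-∪ p q (∁ q) ⟩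
  (p ∩ q) ∪ (p ∩ ∁ q)  ∎
  where open ≡-Reasoning

∣p∣≡∣p∩q∣+∣p∩∁q∣ : ∀ {n} (p q : Subset n) → ∣ p ∣ ≡ ∣ p ∩ q ∣ + ∣ p ∩ ∁ q ∣
∣p∣≡∣p∩q∣+∣p∩∁q∣ []          []          = refl
∣p∣≡∣p∩q∣+∣p∩∁q∣ (true ∷ p)  (true ∷ q)  = cong suc (∣p∣≡∣p∩q∣+∣p∩∁q∣ p q)
∣p∣≡∣p∩q∣+∣p∩∁q∣ (true ∷ p)  (false ∷ q) =
  trans (cong suc (∣p∣≡∣p∩q∣+∣p∩∁q∣ p q)) (sym (+-suc _ _))
∣p∣≡∣p∩q∣+∣p∩∁q∣ (false ∷ p) (_ ∷ q)     = ∣p∣≡∣p∩q∣+∣p∩∁q∣ p q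

∣p∩q∣+∣p∪q∣≡∣p∣+∣q∣ : ∀ {n} (p q : Subset n) → ∣ p ∩ q ∣ + ∣ p ∪ q ∣ ≡ ∣ p ∣ + ∣ q ∣
∣p∩q∣+∣p∪q∣≡∣p∣+∣q∣ []          []          = refl
∣p∩q∣+∣p∪q∣≡∣p∣+∣q∣ (true ∷ p)  (true ∷ q)  = cong suc (begin
  ∣ p ∩ q ∣ + suc ∣ p ∪ q ∣  ≡⟨ +-suc _ _ ⟩
  suc (∣ p ∩ q ∣ + ∣ p ∪ q ∣)  ≡⟨ cong suc (∣p∩q∣+∣p∪q∣≡∣p∣+∣q∣ p q) ⟩
  suc (∣ p ∣ + ∣ q ∣)          ≡⟨ +-suc _ _ ⟨
  ∣ p ∣ + suc ∣ q ∣            ∎)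
  where open ≡-Reasoning
∣p∩q∣+∣p∪q∣≡∣p∣+∣q∣ (true ∷ p)  (false ∷ q) = trans (+-suc _ _) (cong suc (∣p∩q∣+∣p∪q∣≡∣p∣+∣q∣ p q))
∣p∩q∣+∣p∪q∣≡∣p∣+∣q∣ (false ∷ p) (true ∷ q)  =
  trans (+-suc _ _) (trans (cong suc (∣p∩q∣+∣p∪q∣≡∣p∣+∣q∣ p q)) (sym (+-suc _ _)))
∣p∩q∣+∣p∪q∣≡∣p∣+∣q∣ (false ∷ p) (false ∷ q) = ∣p∩q∣+∣p∪q∣≡∣p∣+∣q∣ p q

p≢q⇒∣p∩q∣<∣p∪q∣ : ∀ {n} (p q : Subset n) → p ≢ q → ∣ p ∩ q ∣ < ∣ p ∪ q ∣
p≢q⇒∣p∩q∣<∣p∪q∣ []          []          p≢q = contradiction refl p≢q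
p≢q⇒∣p∩q∣<∣p∪q∣ (true ∷ p)  (true ∷ q)  p≢q = s≤s (p≢q⇒∣p∩q∣<∣p∪q∣ p q (p≢q ∘ cong (true ∷_)))
p≢q⇒∣p∩q∣<∣p∪q∣ (true ∷ p)  (false ∷ q) _   = s≤s (≤-trans (∣p∩q∣≤∣p∣ p q) (∣p∣≤∣p∪q∣ p q))
p≢q⇒∣p∩q∣<∣p∪q∣ (false ∷ p) (true ∷ q)  _   = s≤s (≤-trans (∣p∩q∣≤∣p∣ p q) (∣p∣≤∣p∪q∣ p q))
p≢q⇒∣p∩q∣<∣p∪q∣ (false ∷ p) (false ∷ q) p≢q = p≢q⇒∣p∩q∣<∣p∪q∣ p q (p≢q ∘ cong (false ∷_))

m+m<n+n⇒m<n : ∀ {m n} → m + m < n + n → m < n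
m+m<n+n⇒m<n m+m<n+n = ≰⇒> λ n≤m → <⇒≱ m+m<n+n (+-mono-≤ n≤m n≤m)

∣p∣≡∣q∣≡h∧p≢q⇒∣p∩q∣<h : ∀ {n h} {p q : Subset n} → ∣ p ∣ ≡ h → ∣ q ∣ ≡ h → p ≢ q → ∣ p ∩ q ∣ < h
∣p∣≡∣q∣≡h∧p≢q⇒∣p∩q∣<h {h = h} {p} {q} ∣p∣≡h ∣q∣≡h p≢q = m+m<n+n⇒m<n (begin-strict
  ∣ p ∩ q ∣ + ∣ p ∩ q ∣  <⟨ +-monoʳ-< ∣ p ∩ q ∣ (p≢q⇒∣p∩q∣<∣p∪q∣ p q p≢q) ⟩
  ∣ p ∩ q ∣ + ∣ p ∪ q ∣  ≡⟨ ∣p∩q∣+∣p∪q∣≡∣p∣+∣q∣ p q ⟩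
  ∣ p ∣ + ∣ q ∣          ≡⟨ cong₂ _+_ ∣p∣≡h ∣q∣≡h ⟩
  h + h                  ∎)
  where open ≤-Reasoning

module _ {n} {x : Subset n} where

  [a∪z]∩x≡a : ∀ {a z : Subset n} → a ⊆ x → z ⊆ ∁ x → (a ∪ z) ∩ x ≡ a
  [a∪z]∩x≡a a⊆x z⊆∁x = [p∪q]∩r≡p (p⊆q⇒p∩q≡p a⊆x) (p⊆q∧q∩r≡⊥⇒p∩r≡⊥ z⊆∁x (∩-inverseˡ x))

  [a∪z]∩∁x≡z : ∀ {a z : Subset n} → a ⊆ x → z ⊆ ∁ x → (a ∪ z) ∩ ∁ x ≡ z
  [a∪z]∩∁x≡z {a} {z} a⊆x z⊆∁x = trans (cong (_∩ ∁ x) (∪-comm a z))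
    ([p∪q]∩r≡p (p⊆q⇒p∩q≡p z⊆∁x) (p⊆q∧q∩r≡⊥⇒p∩r≡⊥ a⊆x (∩-inverseʳ x)))

  ∣a∪z∣≡∣a∣+∣z∣ : ∀ {a z : Subset n} → a ⊆ x → z ⊆ ∁ x → ∣ a ∪ z ∣ ≡ ∣ a ∣ + ∣ z ∣
  ∣a∪z∣≡∣a∣+∣z∣ {a} {z} a⊆x z⊆∁x = trans (∣p∣≡∣p∩q∣+∣p∩∁q∣ (a ∪ z) x)
    (cong₂ (λ b c → ∣ b ∣ + ∣ c ∣) ([a∪z]∩x≡a a⊆x z⊆∁x) ([a∪z]∩∁x≡z a⊆x z⊆∁x))

  ∣[a∪z]∩[a′∪z′]∣≡∣a∩a′∣+∣z∩z′∣ : ∀ {a a′ z z′ : Subset n} →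
    a ⊆ x → a′ ⊆ x → z ⊆ ∁ x → z′ ⊆ ∁ x →
    ∣ (a ∪ z) ∩ (a′ ∪ z′) ∣ ≡ ∣ a ∩ a′ ∣ + ∣ z ∩ z′ ∣
  ∣[a∪z]∩[a′∪z′]∣≡∣a∩a′∣+∣z∩z′∣ {a} {a′} {z} {z′} a⊆x a′⊆x z⊆∁x z′⊆∁x =
    trans (∣p∣≡∣p∩q∣+∣p∩∁q∣ ((a ∪ z) ∩ (a′ ∪ z′)) x)
      (cong₂ (λ b c → ∣ b ∣ + ∣ c ∣)
        (trans (∩-distribʳ-∩ x (a ∪ z) (a′ ∪ z′))
               (cong₂ _∩_ ([a∪z]∩x≡a a⊆x z⊆∁x) ([a∪z]∩x≡a a′⊆x z′⊆∁x)))
        (trans (∩-distribʳ-∩ (∁ x) (a ∪ z) (a′ ∪ z′))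
               (cong₂ _∩_ ([a∪z]∩∁x≡z a⊆x z⊆∁x) ([a∪z]∩∁x≡z a′⊆x z′⊆∁x))))
    where ∩-distribʳ-∩ = IdempotentCommutativeMonoidProperties.∙-distrʳ-∙ (∩-idempotentCommutativeMonoid n)

-- Cyclic shifts modulo d

%-absorbˡ : ∀ m n d .{{_ : NonZero d}} → (m % d + n) % d ≡ (m + n) % d
%-absorbˡ m n d = begin
  (m % d + n) % d          ≡⟨ %-distribˡ-+ (m % d) n d ⟩
  (m % d % d + n % d) % d  ≡⟨ cong (λ v → (v + n % d) % d) (m%n%n≡m%n m d) ⟩
  (m % d + n % d) % d      ≡⟨ %-distribˡ-+ m n d ⟨
  (m + n) % d              ∎
  where open ≡-Reasoning

[m+o]%'d≡[n+o]%'d⇒m≡n : ∀ {d m n} o → m < d → n < d → (m + o) %' d ≡ (n + o) %' d → m ≡ n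
[m+o]%'d≡[n+o]%'d⇒m≡n {d@(suc _)} {m} {n} o m<d n<d eq =
  trans (unshift m m<d) (trans (cong shiftBack eq) (sym (unshift n n<d)))
  where
  open ≡-Reasoning
  c = o % d
  shiftBack : ℕ → ℕ
  shiftBack v = (v + (d ∸ c)) % d
  unshift : ∀ k → k < d → k ≡ shiftBack ((k + o) % d)
  unshift k k<d = begin
    k                            ≡⟨ m<n⇒m%n≡m k<d ⟨
    k % d                        ≡⟨ [m+n]%n≡m%n k d ⟨
    (k + d) % d                  ≡⟨ cong (λ v → (k + v) % d) (m+[n∸m]≡n (m%n≤n o d)) ⟨
    (k + (c + (d ∸ c))) % d      ≡⟨ cong (_% d) (+-assoc k c (d ∸ c)) ⟨
    (k + c + (d ∸ c)) % d        ≡⟨ %-absorbˡ (k + c) (d ∸ c) d ⟨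
    ((k + c) % d + (d ∸ c)) % d  ≡⟨ cong shiftBack (cong (_% d) (+-comm k c)) ⟩
    shiftBack ((c + k) % d)      ≡⟨ cong shiftBack (%-absorbˡ o k d) ⟩
    shiftBack ((o + k) % d)      ≡⟨ cong shiftBack (cong (_% d) (+-comm o k)) ⟩
    shiftBack ((k + o) % d)      ∎

[o+m]%'d≡[o+n]%'d⇒m≡n : ∀ {d m n} o → m < d → n < d → (o + m) %' d ≡ (o + n) %' d → m ≡ n
[o+m]%'d≡[o+n]%'d⇒m≡n {d} {m} {n} o m<d n<d eq = [m+o]%'d≡[n+o]%'d⇒m≡n o m<d n<d
  (trans (cong (_%' d) (+-comm m o)) (trans eq (cong (_%' d) (+-comm o n))))

%'-shift-surjective : ∀ {d x y} → x < d → y < d → ∃ λ m → m < d × y ≡ (m + x) %' d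
%'-shift-surjective {d@(suc _)} {x} {y} x<d y<d = (y + (d ∸ x)) % d , m%n<n (y + (d ∸ x)) d , (begin
  y                            ≡⟨ m<n⇒m%n≡m y<d ⟨
  y % d                        ≡⟨ [m+n]%n≡m%n y d ⟨
  (y + d) % d                  ≡⟨ cong (λ v → (y + v) % d) (m∸n+n≡m (<⇒≤ x<d)) ⟨
  (y + (d ∸ x + x)) % d        ≡⟨ cong (_% d) (+-assoc y (d ∸ x) x) ⟨
  (y + (d ∸ x) + x) % d        ≡⟨ %-absorbˡ (y + (d ∸ x)) x d ⟨
  ((y + (d ∸ x)) % d + x) % d  ∎)
  where open ≡-Reasoning

-- Wrapped diagonals of a k × l grid

-- In sMem the rows are the A-indices (k = q_h) and the columns the Z-indices (l = p_h).
Diagonal : {k l : ℕ} → ℕ → Fin k → Fin l → Set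
Diagonal {k} {l} c x y =
  (k ≤ l × toℕ y ≡ (c + toℕ x) %' l) ⊎ (l < k × toℕ x ≡ (c + toℕ y) %' k)

module _ {k l c : ℕ} {x x′ : Fin k} {y y′ : Fin l} where

  Diagonal-functional : Diagonal c x y → Diagonal c x′ y′ → x ≡ x′ → y ≡ y′
  Diagonal-functional (inj₁ (_ , e)) (inj₁ (_ , e′)) refl = toℕ-injective (trans e (sym e′))
  Diagonal-functional (inj₂ (l<k , e)) (inj₂ (_ , e′)) refl = toℕ-injective
    ([o+m]%'d≡[o+n]%'d⇒m≡n c (<-trans (toℕ<n y) l<k) (<-trans (toℕ<n y′) l<k) (trans (sym e) e′))
  Diagonal-functional (inj₁ (k≤l , _)) (inj₂ (l<k , _)) _ = contradiction k≤l (<⇒≱ l<k)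
  Diagonal-functional (inj₂ (l<k , _)) (inj₁ (k≤l , _)) _ = contradiction k≤l (<⇒≱ l<k)

  Diagonal-injective : Diagonal c x y → Diagonal c x′ y′ → y ≡ y′ → x ≡ x′
  Diagonal-injective (inj₁ (k≤l , e)) (inj₁ (_ , e′)) refl = toℕ-injective
    ([o+m]%'d≡[o+n]%'d⇒m≡n c (<-≤-trans (toℕ<n x) k≤l) (<-≤-trans (toℕ<n x′) k≤l) (trans (sym e) e′))
  Diagonal-injective (inj₂ (_ , e)) (inj₂ (_ , e′)) refl = toℕ-injective (trans e (sym e′))
  Diagonal-injective (inj₁ (k≤l , _)) (inj₂ (l<k , _)) _ = contradiction k≤l (<⇒≱ l<k)
  Diagonal-injective (inj₂ (l<k , _)) (inj₁ (k≤l , _)) _ = contradiction k≤l (<⇒≱ l<k)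

Diagonal-unique : ∀ {k l c c′} {x : Fin k} {y : Fin l} → c < l ⊔ k → c′ < l ⊔ k →
  Diagonal c x y → Diagonal c′ x y → c ≡ c′
Diagonal-unique {x = x} c< c′< (inj₁ (k≤l , e)) (inj₁ (_ , e′)) =
  [m+o]%'d≡[n+o]%'d⇒m≡n (toℕ x) (subst (_ <_) l⊔k≡l c<) (subst (_ <_) l⊔k≡l c′<) (trans (sym e) e′)
  where l⊔k≡l = m≥n⇒m⊔n≡m k≤l
Diagonal-unique {y = y} c< c′< (inj₂ (l<k , e)) (inj₂ (_ , e′)) =
  [m+o]%'d≡[n+o]%'d⇒m≡n (toℕ y) (subst (_ <_) l⊔k≡k c<) (subst (_ <_) l⊔k≡k c′<) (trans (sym e) e′)
  where l⊔k≡k = m≤n⇒m⊔n≡n (<⇒≤ l<k)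
Diagonal-unique _ _ (inj₁ (k≤l , _)) (inj₂ (l<k , _)) = contradiction k≤l (<⇒≱ l<k)
Diagonal-unique _ _ (inj₂ (l<k , _)) (inj₁ (k≤l , _)) = contradiction k≤l (<⇒≱ l<k)

Diagonal-cover : ∀ {k l} (x : Fin k) (y : Fin l) → ∃ λ c → c < l ⊔ k × Diagonal c x y
Diagonal-cover {k} {l} x y with k ≤? l
... | yes k≤l with %'-shift-surjective (<-≤-trans (toℕ<n x) k≤l) (toℕ<n y)
...   | c , c<l , e = c , <-≤-trans c<l (m≤m⊔n l k) , inj₁ (k≤l , e)
Diagonal-cover {k} {l} x y | no k≰l with %'-shift-surjective (<-trans (toℕ<n y) (≰⇒> k≰l)) (toℕ<n x)
...   | c , c<k , e = c , <-≤-trans c<k (m≤n⊔m l k) , inj₂ (≰⇒> k≰l , e)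

maxWhere-upperBound : ∀ P f {h} r → h ≤ r → P h ≡ true → f h ≤ maxWhere P f r
maxWhere-upperBound P f zero    z≤n  Ph rewrite Ph = ≤-refl
maxWhere-upperBound P f {h} (suc r) h≤1+r Ph with h ≟ suc r
... | yes refl rewrite Ph = m≤n⊔m (maxWhere P f r) (f (suc r))
... | no h≢1+r = ≤-trans (maxWhere-upperBound P f r (<⇒≤pred (≤∧≢⇒< h≤1+r h≢1+r)) Ph) (m≤m⊔n _ _)

mm≤αβ : ∀ n r {h} → h ≤ r → mm n r h ≤ αβ n r (isOdd h)
mm≤αβ n r {h} h≤r with isOdd h in odd
... | true  = maxWhere-upperBound isOdd (mm n r) r h≤r odd
... | false = maxWhere-upperBound (not ∘ isOdd) (mm n r) r h≤r (cong not odd)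

isOdd-h≡isOdd-h′⇒2+h≤h′ : ∀ {h h′} → h < h′ → isOdd h ≡ isOdd h′ → 2 + h ≤ h′
isOdd-h≡isOdd-h′⇒2+h≤h′ h<h′ same = ≤∧≢⇒< h<h′ λ 1+h≡h′ → not-¬ refl (trans same (cong isOdd (sym 1+h≡h′)))

m<o∧n<p∸o⇒m+n≤p∸2 : ∀ {m n o p} → m < o → n < p ∸ o → o ≤ p → m + n ≤ p ∸ 2
m<o∧n<p∸o⇒m+n≤p∸2 {m} {n} {o} {p} m<o n<p∸o o≤p = m+n≤o⇒m≤o∸n (m + n) (begin
  m + n + 2      ≡⟨ +-comm (m + n) 2 ⟩
  2 + (m + n)    ≡⟨ cong suc (+-suc m n) ⟨
  suc m + suc n  ≤⟨ +-mono-≤ m<o n<p∸o ⟩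
  o + (p ∸ o)    ≡⟨ m+[n∸m]≡n o≤p ⟩
  p              ∎)
  where open ≤-Reasoning

m≤o∧n≤p∸q∧2+o≤q⇒m+n≤p∸2 : ∀ {m n o p q} → m ≤ o → n ≤ p ∸ q → 2 + o ≤ q → q ≤ p → m + n ≤ p ∸ 2
m≤o∧n≤p∸q∧2+o≤q⇒m+n≤p∸2 {m} {n} {o} {p} {q} m≤o n≤p∸q 2+o≤q q≤p = m+n≤o⇒m≤o∸n (m + n) (begin
  m + n + 2    ≡⟨ +-comm (m + n) 2 ⟩
  2 + m + n    ≤⟨ +-mono-≤ (≤-trans (s≤s (s≤s m≤o)) 2+o≤q) n≤p∸q ⟩
  q + (p ∸ q)  ≡⟨ m+[n∸m]≡n q≤p ⟩
  p            ∎)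
  where open ≤-Reasoning

module Construction
  {n r : ℕ} {X : Subset n}
  {A : (h : ℕ) → Fin (qq r h) → Subset n}
  {Z : (h : ℕ) → Fin (pp n r h) → Subset n}
  (enumA : (h : ℕ) → h ≤ r → IsEnumeration (h -SubsetOf X) (A h))
  (enumZ : (h : ℕ) → h ≤ r → IsEnumeration ((r ∸ h) -SubsetOf (∁ X)) (Z h))
  where

  A⊆X : ∀ {h} → h ≤ r → (t : Fin (qq r h)) → A h t ⊆ X
  A⊆X h≤r t = proj₁ (proj₁ (proj₂ (enumA _ h≤r)) t)

  ∣A∣≡h : ∀ {h} → h ≤ r → (t : Fin (qq r h)) → ∣ A h t ∣ ≡ h
  ∣A∣≡h h≤r t = proj₂ (proj₁ (proj₂ (enumA _ h≤r)) t)

  Z⊆∁X : ∀ {h} → h ≤ r → (u : Fin (pp n r h)) → Z h u ⊆ ∁ X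
  Z⊆∁X h≤r u = proj₁ (proj₁ (proj₂ (enumZ _ h≤r)) u)

  ∣Z∣≡r∸h : ∀ {h} → h ≤ r → (u : Fin (pp n r h)) → ∣ Z h u ∣ ≡ r ∸ h
  ∣Z∣≡r∸h h≤r u = proj₂ (proj₁ (proj₂ (enumZ _ h≤r)) u)

  [A∪Z]∩X≡A : ∀ {h} (h≤r : h ≤ r) t u → (A h t ∪ Z h u) ∩ X ≡ A h t
  [A∪Z]∩X≡A h≤r t u = [a∪z]∩x≡a (A⊆X h≤r t) (Z⊆∁X h≤r u)

  [A∪Z]∩∁X≡Z : ∀ {h} (h≤r : h ≤ r) t u → (A h t ∪ Z h u) ∩ ∁ X ≡ Z h u
  [A∪Z]∩∁X≡Z h≤r t u = [a∪z]∩∁x≡z (A⊆X h≤r t) (Z⊆∁X h≤r u)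

  ∣A∪Z∣≡r : ∀ {h} (h≤r : h ≤ r) t u → ∣ A h t ∪ Z h u ∣ ≡ r
  ∣A∪Z∣≡r h≤r t u = trans (∣a∪z∣≡∣a∣+∣z∣ (A⊆X h≤r t) (Z⊆∁X h≤r u))
    (trans (cong₂ _+_ (∣A∣≡h h≤r t) (∣Z∣≡r∸h h≤r u)) (m+[n∸m]≡n h≤r))

  A∪Z-level : ∀ {h h′ t u t′ u′} → h ≤ r → h′ ≤ r → A h t ∪ Z h u ≡ A h′ t′ ∪ Z h′ u′ → h ≡ h′
  A∪Z-level {t = t} {u} {t′} {u′} h≤r h′≤r e = begin
    _                        ≡⟨ ∣A∣≡h h≤r t ⟨
    ∣ A _ t ∣                ≡⟨ cong ∣_∣ ([A∪Z]∩X≡A h≤r t u) ⟨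
    ∣ (A _ t ∪ Z _ u) ∩ X ∣  ≡⟨ cong (λ b → ∣ b ∩ X ∣) e ⟩
    ∣ (A _ t′ ∪ Z _ u′) ∩ X ∣ ≡⟨ cong ∣_∣ ([A∪Z]∩X≡A h′≤r t′ u′) ⟩
    ∣ A _ t′ ∣               ≡⟨ ∣A∣≡h h′≤r t′ ⟩
    _                        ∎
    where open ≡-Reasoning

  A∪Z-injective : ∀ {h t u t′ u′} (h≤r : h ≤ r) → A h t ∪ Z h u ≡ A h t′ ∪ Z h u′ → t ≡ t′ × u ≡ u′
  A∪Z-injective {t = t} {u} {t′} {u′} h≤r e =
    proj₁ (enumA _ h≤r) (trans (sym ([A∪Z]∩X≡A h≤r t u)) (trans (cong (_∩ X) e) ([A∪Z]∩X≡A h≤r t′ u′))) ,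
    proj₁ (enumZ _ h≤r) (trans (sym ([A∪Z]∩∁X≡Z h≤r t u)) (trans (cong (_∩ ∁ X) e) ([A∪Z]∩∁X≡Z h≤r t′ u′)))

  decompose : ∀ {B} → ∣ B ∣ ≡ r → Σ ℕ λ h → h ≤ r × Σ (Fin (qq r h)) λ t → Σ (Fin (pp n r h)) λ u → B ≡ A h t ∪ Z h u
  decompose {B} ∣B∣≡r = h , h≤r , proj₁ preimageA , proj₁ preimageZ , (begin
    B                    ≡⟨ p≡[p∩q]∪[p∩∁q] B X ⟩
    (B ∩ X) ∪ (B ∩ ∁ X)  ≡⟨ cong₂ _∪_ (proj₂ preimageA) (proj₂ preimageZ) ⟨
    A h _ ∪ Z h _        ∎)
    where
    open ≡-Reasoning
    h = ∣ B ∩ X ∣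
    h≤r : h ≤ r
    h≤r = ≤-trans (∣p∩q∣≤∣p∣ B X) (≤-reflexive ∣B∣≡r)
    ∣B∩∁X∣≡r∸h : ∣ B ∩ ∁ X ∣ ≡ r ∸ h
    ∣B∩∁X∣≡r∸h = trans (sym (m+n∸m≡n h _)) (cong (_∸ h) (trans (sym (∣p∣≡∣p∩q∣+∣p∩∁q∣ B X)) ∣B∣≡r))
    preimageA = proj₂ (proj₂ (enumA h h≤r)) (B ∩ X) (p∩q⊆q B X , refl)
    preimageZ = proj₂ (proj₂ (enumZ h h≤r)) (B ∩ ∁ X) (p∩q⊆q B (∁ X) , ∣B∩∁X∣≡r∸h)

  -- Cell h c is the set s_h(c + 1) of the paper.
  Cell : ℕ → ℕ → Subset n → Set
  Cell h c B = Σ (Fin (qq r h)) λ t → Σ (Fin (pp n r h)) λ u → Diagonal c t u × B ≡ A h t ∪ Z h u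

  sMem⇒Cell : ∀ {h c B} → sMem r A Z h (suc c) B → Cell h c B
  sMem⇒Cell (_ , _ , inj₁ (q≤p , t , u , e , B≡)) = t , u , inj₁ (q≤p , e) , B≡
  sMem⇒Cell (_ , _ , inj₂ (p<q , i , u , e , B≡)) = u , i , inj₂ (p<q , e) , B≡

  Cell⇒sMem : ∀ {h c B} → c < mm n r h → Cell h c B → sMem r A Z h (suc c) B
  Cell⇒sMem c<m (t , u , inj₁ (q≤p , e) , B≡) = s≤s z≤n , c<m , inj₁ (q≤p , t , u , e , B≡)
  Cell⇒sMem c<m (t , u , inj₂ (p<q , e) , B≡) = s≤s z≤n , c<m , inj₂ (p<q , u , t , e , B≡)

  sMem-unique : ∀ {h h′ c c′ B} → h ≤ r → h′ ≤ r →
    sMem r A Z h (suc c) B → sMem r A Z h′ (suc c′) B → h ≡ h′ × c ≡ c′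
  sMem-unique h≤r h′≤r m m′ with sMem⇒Cell m | sMem⇒Cell m′
  ... | t , u , d , refl | t′ , u′ , d′ , e with A∪Z-level h≤r h′≤r e
  ... | refl with A∪Z-injective h≤r e
  ... | refl , refl = refl , Diagonal-unique (proj₁ (proj₂ m)) (proj₁ (proj₂ m′)) d d′

  same-level-bound : ∀ {h c B B′} → h ≤ r → Cell h c B → Cell h c B′ → B ≢ B′ → ∣ B ∩ B′ ∣ ≤ r ∸ 2
  same-level-bound {h} h≤r (t , u , d , refl) (t′ , u′ , d′ , refl) B≢B′ = begin
    ∣ (A h t ∪ Z h u) ∩ (A h t′ ∪ Z h u′) ∣  ≡⟨ ∣[a∪z]∩[a′∪z′]∣≡∣a∩a′∣+∣z∩z′∣
                                                  (A⊆X h≤r t) (A⊆X h≤r t′) (Z⊆∁X h≤r u) (Z⊆∁X h≤r u′) ⟩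
    ∣ A h t ∩ A h t′ ∣ + ∣ Z h u ∩ Z h u′ ∣  ≤⟨ m<o∧n<p∸o⇒m+n≤p∸2 ∣A∩A′∣<h ∣Z∩Z′∣<r∸h h≤r ⟩
    r ∸ 2                                    ∎
    where
    open ≤-Reasoning
    t≢t′ : t ≢ t′
    t≢t′ t≡t′ = B≢B′ (cong₂ (λ a b → A h a ∪ Z h b) t≡t′ (Diagonal-functional d d′ t≡t′))
    ∣A∩A′∣<h = ∣p∣≡∣q∣≡h∧p≢q⇒∣p∩q∣<h (∣A∣≡h h≤r t) (∣A∣≡h h≤r t′) (t≢t′ ∘ proj₁ (enumA h h≤r))
    ∣Z∩Z′∣<r∸h = ∣p∣≡∣q∣≡h∧p≢q⇒∣p∩q∣<h (∣Z∣≡r∸h h≤r u) (∣Z∣≡r∸h h≤r u′)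
      (t≢t′ ∘ Diagonal-injective d d′ ∘ proj₁ (enumZ h h≤r))

  distant-levels-bound : ∀ {h h′ c c′ B B′} → h ≤ r → h′ ≤ r → 2 + h ≤ h′ →
    Cell h c B → Cell h′ c′ B′ → ∣ B ∩ B′ ∣ ≤ r ∸ 2
  distant-levels-bound {h} {h′} h≤r h′≤r 2+h≤h′ (t , u , _ , refl) (t′ , u′ , _ , refl) = begin
    ∣ (A h t ∪ Z h u) ∩ (A h′ t′ ∪ Z h′ u′) ∣  ≡⟨ ∣[a∪z]∩[a′∪z′]∣≡∣a∩a′∣+∣z∩z′∣
                                                    (A⊆X h≤r t) (A⊆X h′≤r t′) (Z⊆∁X h≤r u) (Z⊆∁X h′≤r u′) ⟩
    ∣ A h t ∩ A h′ t′ ∣ + ∣ Z h u ∩ Z h′ u′ ∣  ≤⟨ m≤o∧n≤p∸q∧2+o≤q⇒m+n≤p∸2 ∣A∩A′∣≤h ∣Z∩Z′∣≤r∸h′ 2+h≤h′ h′≤r ⟩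
    r ∸ 2                                      ∎
    where
    open ≤-Reasoning
    ∣A∩A′∣≤h = ≤-trans (∣p∩q∣≤∣p∣ (A h t) (A h′ t′)) (≤-reflexive (∣A∣≡h h≤r t))
    ∣Z∩Z′∣≤r∸h′ = ≤-trans (∣p∩q∣≤∣q∣ (Z h u) (Z h′ u′)) (≤-reflexive (∣Z∣≡r∸h h′≤r u′))

  UMem-** : ∀ {b j B B′} → UMem r A Z b j B → UMem r A Z b j B′ → B ≢ B′ → ∣ B ∩ B′ ∣ ≤ r ∸ 2
  UMem-** {B = B} {B′} (h , h≤r , refl , m@(s≤s z≤n , _)) (h′ , h′≤r , same , m′) B≢B′ with <-cmp h h′
  ... | tri≈ _ refl _ = same-level-bound h≤r (sMem⇒Cell m) (sMem⇒Cell m′) B≢B′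
  ... | tri< h<h′ _ _ =
    distant-levels-bound h≤r h′≤r (isOdd-h≡isOdd-h′⇒2+h≤h′ h<h′ (sym same)) (sMem⇒Cell m) (sMem⇒Cell m′)
  ... | tri> _ _ h′<h = subst (_≤ r ∸ 2) (cong ∣_∣ (∩-comm B′ B))
    (distant-levels-bound h′≤r h≤r (isOdd-h≡isOdd-h′⇒2+h≤h′ h′<h same) (sMem⇒Cell m′) (sMem⇒Cell m))

  UMem-unique : ∀ {b b′ j j′ B} → UMem r A Z b j B → UMem r A Z b′ j′ B → b ≡ b′ × j ≡ j′
  UMem-unique (h , h≤r , refl , m@(s≤s z≤n , _)) (h′ , h′≤r , refl , m′@(s≤s z≤n , _))
    with sMem-unique h≤r h′≤r m m′
  ... | refl , refl = refl , refl

  UMem⇒∣B∣≡r : ∀ {b j B} → UMem r A Z b j B → ∣ B ∣ ≡ r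
  UMem⇒∣B∣≡r (h , h≤r , _ , m@(s≤s z≤n , _)) with sMem⇒Cell m
  ... | t , u , _ , refl = ∣A∪Z∣≡r h≤r t u

  ∣B∣≡r⇒UMem : ∀ {B} → ∣ B ∣ ≡ r → Σ Bool λ b → Σ ℕ λ j → 1 ≤ j × j ≤ αβ n r b × UMem r A Z b j B
  ∣B∣≡r⇒UMem ∣B∣≡r with decompose ∣B∣≡r
  ... | h , h≤r , t , u , B≡ with Diagonal-cover t u
  ... | c , c<m , d = isOdd h , suc c , s≤s z≤n , ≤-trans c<m (mm≤αβ _ r h≤r) ,
                      h , h≤r , refl , Cell⇒sMem c<m (t , u , d , B≡)

-- The hypotheses 2 ≤ r, r ≤ n - 1 and |X| = r only guarantee that the enumerations exist;
-- the argument itself runs on the enumerations alone.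
mainTheorem6 : (n r : ℕ) → 2 ≤ r → r ≤ n ∸ 1 →
    (X : Subset n) → ∣ X ∣ ≡ r →
    (A : (h : ℕ) → Fin (qq r h) → Subset n) →
    (Z : (h : ℕ) → Fin (pp n r h) → Subset n) →
    ((h : ℕ) → h ≤ r → IsEnumeration (h -SubsetOf X) (A h)) →
    ((h : ℕ) → h ≤ r → IsEnumeration ((r ∸ h) -SubsetOf (∁ X)) (Z h)) →
    ((b : Bool) (j : ℕ) → 1 ≤ j → j ≤ αβ n r b → (B B′ : Subset n) →
        UMem r A Z b j B → UMem r A Z b j B′ → ¬ B ≡ B′ → ∣ B ∩ B′ ∣ ≤ r ∸ 2)
    × ((b b′ : Bool) (j j′ : ℕ) → 1 ≤ j → j ≤ αβ n r b → 1 ≤ j′ → j′ ≤ αβ n r b′ →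
        (B : Subset n) → UMem r A Z b j B → UMem r A Z b′ j′ B → b ≡ b′ × j ≡ j′)
    × ((B : Subset n) → (Σ Bool λ b → Σ ℕ λ j → 1 ≤ j × j ≤ αβ n r b × UMem r A Z b j B)
        → ∣ B ∣ ≡ r)
    × ((B : Subset n) → ∣ B ∣ ≡ r →
        Σ Bool λ b → Σ ℕ λ j → 1 ≤ j × j ≤ αβ n r b × UMem r A Z b j B)
mainTheorem6 n r _ _ X _ A Z enumA enumZ =
  (λ _ _ _ _ _ _ → UMem-**) ,
  (λ _ _ _ _ _ _ _ _ _ → UMem-unique) ,
  (λ { _ (_ , _ , _ , _ , m) → UMem⇒∣B∣≡r m }) ,
  (λ _ → ∣B∣≡r⇒UMem)
  where open Construction enumA enumZ
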